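{- There are infinitely many pairs of relatively prime integers $(a,b)$ with $a^2+11ab-b^2=19$. Moreover, every integer solution $(a,b)\in\mathbb{Z}^2$ of $a^2+11ab-b^2=19$ satisfies $\left(\frac{ -5(a^2+b^2)}{19}\right)=-1$.
   Context: $\left(\frac{\cdot}{19}\right)$ denotes the Legendre symbol modulo $19$. -}

module Defs where

open import Data.Integer using (ℤ; +_; _+_; _-_; _*_; -_; ∣_∣)
open import Data.Integer.Divisibility using (_∣_)
open import Data.Nat using (ℕ; _≤_)
open import Data.Product using (∃; _×_)
open import Relation.Nullary using (¬_)
open import Relation.Binary.PropositionalEquality using (_≡_)
open import Data.Nat.Coprimality using (Coprime)

Q : ℤ → ℤ → ℤ
Q a b = a * a + (+ 11) * a * b - b * b

IsQR19 : ℤ → Set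
IsQR19 x = ∃ λ (y : ℤ) → (+ 19) ∣ (y * y - x)

LegendreMinusOne19 : ℤ → Set
LegendreMinusOne19 x = ¬ ((+ 19) ∣ x) × ¬ IsQR19 x

Coprimeℤ : ℤ → ℤ → Set
Coprimeℤ a b = Coprime ∣ a ∣ ∣ b ∣

module Submission where

-- The map (a , b) ↦ (b , a + 11 b) sends Q to -Q, so its square (a , b) ↦ (a + 11 b , 11 a + 122 b)
-- preserves Q, and its orbit through the solution (1 , 2) is unbounded. A common divisor d of a
-- solution satisfies d² ∣ Q a b = 19, so every solution is primitive; in particular 19 does not divide
-- both a and b. Reducing mod 19, Q a b ≡ 0 forces a ≡ 10 b or a ≡ -2 b, whence -5 (a² + b²) is 8 b²
-- or 13 b², and 8, 13 are non-residues mod 19; the proof checks this over all residues.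

open import Defs
open import Data.Integer using (ℤ; +_; _+_; _-_; _*_; -_; ∣_∣; _%ℕ_; _/ℕ_)
import Data.Integer.Properties as ℤ
open import Data.Integer.DivMod using (a≡a%ℕn+[a/ℕn]*n; n%ℕd<d)
open import Data.Integer.Divisibility.Signed
  using (_∣_; _∣?_; divides; ∣ᵤ⇒∣; ∣⇒∣ᵤ; ∣m∣n⇒∣m+n; ∣m∣n⇒∣m-n; ∣m⇒∣m*n; ∣n⇒∣m*n)
open import Data.Integer.Divisibility using () renaming (_∣_ to _∣ᵤ_)
open import Data.Integer.Tactic.RingSolver using (solve-∀)
open import Data.Nat using (ℕ; zero; suc; _≤_; _<_; s≤s; z≤n; NonZero; >-nonZero; nonTrivial⇒≢1)
  renaming (_+_ to _+ℕ_; _*_ to _*ℕ_)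
import Data.Nat
import Data.Nat.Properties as ℕ
import Data.Nat.Divisibility as ℕ
open import Data.Nat.Primality using (Prime; prime?; prime⇒irreducible; prime⇒nonZero; prime⇒nonTrivial)
open import Data.Fin as Fin using (Fin; toℕ; fromℕ<)
open import Data.Fin.Properties using (all?; toℕ-fromℕ<)
open import Data.Product using (∃; ∃₂; _×_; _,_; proj₁; proj₂)
open import Data.Sum using (inj₁; inj₂)
open import Relation.Nullary using (¬_; Dec; contradiction)
open import Relation.Nullary.Decidable using (from-yes; _→-dec_; _×-dec_)
open import Relation.Binary.PropositionalEquality using (_≡_; refl; sym; trans; cong; cong₂; subst; module ≡-Reasoning)

infix 4 _≡_mod_

-- A record rather than a synonym for m ∣ x - y, so that x and y are inferable from the type.
record _≡_mod_ (x y m : ℤ) : Set where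
  constructor mod-by
  field difference : m ∣ x - y

≡mod-refl : ∀ {m} x → x ≡ x mod m
≡mod-refl x = mod-by (subst (_ ∣_) (sym (ℤ.+-inverseʳ x)) (divides (+ 0) refl))

∣-resp-≡mod : ∀ {m x y} → x ≡ y mod m → m ∣ x → m ∣ y
∣-resp-≡mod {m} {x} {y} (mod-by m∣x-y) m∣x = subst (m ∣_) (cancel x y) (∣m∣n⇒∣m-n m∣x m∣x-y)
  where
  cancel : ∀ x y → x - (x - y) ≡ y
  cancel = solve-∀

+-cong-≡mod : ∀ {m x x′ y y′} → x ≡ x′ mod m → y ≡ y′ mod m → x + y ≡ x′ + y′ mod m
+-cong-≡mod {m} {x} {x′} {y} {y′} (mod-by p) (mod-by q) =
  mod-by (subst (m ∣_) (regroup x x′ y y′) (∣m∣n⇒∣m+n p q))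
  where
  regroup : ∀ x x′ y y′ → (x - x′) + (y - y′) ≡ (x + y) - (x′ + y′)
  regroup = solve-∀

-cong-≡mod : ∀ {m x x′ y y′} → x ≡ x′ mod m → y ≡ y′ mod m → x - y ≡ x′ - y′ mod m
-cong-≡mod {m} {x} {x′} {y} {y′} (mod-by p) (mod-by q) =
  mod-by (subst (m ∣_) (regroup x x′ y y′) (∣m∣n⇒∣m-n p q))
  where
  regroup : ∀ x x′ y y′ → (x - x′) - (y - y′) ≡ (x - y) - (x′ - y′)
  regroup = solve-∀

*-cong-≡mod : ∀ {m x x′ y y′} → x ≡ x′ mod m → y ≡ y′ mod m → x * y ≡ x′ * y′ mod m
*-cong-≡mod {m} {x} {x′} {y} {y′} (mod-by p) (mod-by q) =
  mod-by (subst (m ∣_) (regroup x x′ y y′) (∣m∣n⇒∣m+n (∣n⇒∣m*n x q) (∣m⇒∣m*n y′ p)))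
  where
  regroup : ∀ x x′ y y′ → x * (y - y′) + (x - x′) * y′ ≡ x * y - x′ * y′
  regroup = solve-∀

≡0mod⇒∣ : ∀ {m x} → x ≡ + 0 mod m → m ∣ x
≡0mod⇒∣ {m} {x} (mod-by m∣x-0) = subst (m ∣_) (ℤ.+-identityʳ x) m∣x-0

residue : ∀ d .{{_ : NonZero d}} x → ∃ λ (r : Fin d) → x ≡ + toℕ r mod + d
residue d x = fromℕ< (n%ℕd<d x d) , mod-by (subst (+ d ∣_) remainder (divides (x /ℕ d) refl))
  where
  cancel : ∀ r q → q ≡ (r + q) - r
  cancel = solve-∀
  remainder : (x /ℕ d) * + d ≡ x - + toℕ (fromℕ< (n%ℕd<d x d))
  remainder = trans (cancel (+ (x %ℕ d)) _)
    (cong₂ _-_ (sym (a≡a%ℕn+[a/ℕn]*n x d)) (cong +_ (sym (toℕ-fromℕ< (n%ℕd<d x d)))))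

sumSq : ℤ → ℤ → ℤ
sumSq a b = a * a + b * b

Q-cong-≡mod : ∀ {m a a′ b b′} → a ≡ a′ mod m → b ≡ b′ mod m → Q a b ≡ Q a′ b′ mod m
Q-cong-≡mod p q =
  -cong-≡mod (+-cong-≡mod (*-cong-≡mod p p) (*-cong-≡mod (*-cong-≡mod (≡mod-refl (+ 11)) p) q)) (*-cong-≡mod q q)

sumSq-cong-≡mod : ∀ {m a a′ b b′} → a ≡ a′ mod m → b ≡ b′ mod m → sumSq a b ≡ sumSq a′ b′ mod m
sumSq-cong-≡mod p q = +-cong-≡mod (*-cong-≡mod p p) (*-cong-≡mod q q)

m∣a⇒m∣b⇒m*m∣Q : ∀ {m a b} → m ∣ a → m ∣ b → m * m ∣ Q a b
m∣a⇒m∣b⇒m*m∣Q {m} (divides p refl) (divides q refl) = divides (Q p q) (homogeneous p q m)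
  where
  homogeneous : ∀ p q m → (p * m) * (p * m) + + 11 * (p * m) * (q * m) - (q * m) * (q * m)
                        ≡ (p * p + + 11 * p * q - q * q) * (m * m)
  homogeneous = solve-∀

d*d∣p⇒d≡1 : ∀ {p d} → Prime p → d *ℕ d ℕ.∣ p → d ≡ 1
d*d∣p⇒d≡1 {p} {d} p-prime d*d∣p with prime⇒irreducible p-prime (ℕ.∣-trans (ℕ.m∣m*n d) d*d∣p)
... | inj₁ d≡1 = d≡1
... | inj₂ refl = contradiction (ℕ.∣1⇒≡1 (ℕ.*-cancelˡ-∣ p {{prime⇒nonZero p-prime}} p*p∣p*1))
                                (nonTrivial⇒≢1 {{prime⇒nonTrivial p-prime}})
  where
  p*p∣p*1 : p *ℕ p ℕ.∣ p *ℕ 1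
  p*p∣p*1 = subst (p *ℕ p ℕ.∣_) (sym (ℕ.*-identityʳ p)) d*d∣p

Q≡19⇒common-divisor≡1 : ∀ {a b d} → Q a b ≡ + 19 → + d ∣ a → + d ∣ b → d ≡ 1
Q≡19⇒common-divisor≡1 {d = d} Q≡19 d∣a d∣b =
  d*d∣p⇒d≡1 (from-yes (prime? 19)) (subst (ℕ._∣ 19) (ℤ.abs-* (+ d) (+ d))
    (∣⇒∣ᵤ (subst (+ d * + d ∣_) Q≡19 (m∣a⇒m∣b⇒m*m∣Q d∣a d∣b))))

SquareRootMod19 : ℤ → ℤ → Set
SquareRootMod19 y x = + 19 ∣ y * y - x

ZeroIfSquareMod19 : Fin 19 → Fin 19 → Fin 19 → Set
ZeroIfSquareMod19 r s u =
  + 19 ∣ Q (+ toℕ r) (+ toℕ s) → SquareRootMod19 (+ toℕ u) (- (+ 5) * sumSq (+ toℕ r) (+ toℕ s)) →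
  r ≡ Fin.zero × s ≡ Fin.zero

zeroIfSquareMod19? : ∀ r s u → Dec (ZeroIfSquareMod19 r s u)
zeroIfSquareMod19? r s u =
  (+ 19 ∣? _) →-dec (+ 19 ∣? _) →-dec (r Fin.≟ Fin.zero) ×-dec (s Fin.≟ Fin.zero)

-- Abstract, so that uses of this 19³-case computation do not unfold it.
abstract
  zeroIfSquareMod19 : ∀ r s u → ZeroIfSquareMod19 r s u
  zeroIfSquareMod19 = from-yes (all? λ r → all? λ s → all? (zeroIfSquareMod19? r s))

solution⇒¬SquareRootMod19 : ∀ {a b} → Q a b ≡ + 19 → ∀ y → ¬ SquareRootMod19 y (- (+ 5) * sumSq a b)
solution⇒¬SquareRootMod19 {a} {b} Q≡19 y y²≡x
  with residue 19 a | residue 19 b | residue 19 y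
... | r , a≡r | s , b≡s | u , y≡u =
  let r≡0 , s≡0 = zeroIfSquareMod19 r s u 19∣Qrs square in
  contradiction (Q≡19⇒common-divisor≡1 Q≡19 (divisible a≡r r≡0) (divisible b≡s s≡0)) λ ()
  where
  19∣Qrs : + 19 ∣ Q (+ toℕ r) (+ toℕ s)
  19∣Qrs = ∣-resp-≡mod (Q-cong-≡mod a≡r b≡s) (divides (+ 1) Q≡19)
  square : SquareRootMod19 (+ toℕ u) (- (+ 5) * sumSq (+ toℕ r) (+ toℕ s))
  square = ∣-resp-≡mod (-cong-≡mod (*-cong-≡mod y≡u y≡u)
                                   (*-cong-≡mod (≡mod-refl (- (+ 5))) (sumSq-cong-≡mod a≡r b≡s))) y²≡x
  divisible : ∀ {x} {r : Fin 19} → x ≡ + toℕ r mod + 19 → r ≡ Fin.zero → + 19 ∣ x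
  divisible x≡r refl = ≡0mod⇒∣ x≡r

¬square⇒LegendreMinusOne19 : ∀ {x} → (∀ y → ¬ SquareRootMod19 y x) → LegendreMinusOne19 x
¬square⇒LegendreMinusOne19 {x} ¬square = ¬19∣x , ¬QR
  where
  ¬QR : ¬ IsQR19 x
  ¬QR (y , 19∣y²-x) = ¬square y (∣ᵤ⇒∣ 19∣y²-x)
  ¬19∣x : ¬ (+ 19 ∣ᵤ x)
  ¬19∣x 19∣x = ¬square (+ 0) (∣m∣n⇒∣m-n {+ 19} {+ 0} {x} (divides (+ 0) refl) (∣ᵤ⇒∣ 19∣x))

solution⇒coprime : ∀ {a b} → Q a b ≡ + 19 → Coprimeℤ a b
solution⇒coprime {a} {b} Q≡19 (i∣a , i∣b) = Q≡19⇒common-divisor≡1 {a} {b} Q≡19 (∣ᵤ⇒∣ i∣a) (∣ᵤ⇒∣ i∣b)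

Q-next : ∀ a b → Q (a + + 11 * b) (+ 11 * a + + 122 * b) ≡ Q a b
Q-next = expanded
  where
  expanded : ∀ a b → (a + + 11 * b) * (a + + 11 * b) + + 11 * (a + + 11 * b) * (+ 11 * a + + 122 * b)
                       - (+ 11 * a + + 122 * b) * (+ 11 * a + + 122 * b)
                   ≡ a * a + + 11 * a * b - b * b
  expanded = solve-∀

next : ℕ × ℕ → ℕ × ℕ
next (a , b) = a +ℕ 11 *ℕ b , 11 *ℕ a +ℕ 122 *ℕ b

Q⁺ : ℕ × ℕ → ℤ
Q⁺ (a , b) = Q (+ a) (+ b)

Q⁺-next : ∀ p → Q⁺ (next p) ≡ Q⁺ p
Q⁺-next (a , b) = begin
  Q (+ (a +ℕ 11 *ℕ b)) (+ (11 *ℕ a +ℕ 122 *ℕ b))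
    ≡⟨ cong₂ Q (trans (ℤ.pos-+ a (11 *ℕ b)) (cong (_+_ (+ a)) (ℤ.pos-* 11 b)))
               (trans (ℤ.pos-+ (11 *ℕ a) (122 *ℕ b)) (cong₂ _+_ (ℤ.pos-* 11 a) (ℤ.pos-* 122 b))) ⟩
  Q (+ a + + 11 * + b) (+ 11 * + a + + 122 * + b)
    ≡⟨ Q-next (+ a) (+ b) ⟩
  Q (+ a) (+ b) ∎
  where
  open ≡-Reasoning

next-grows : ∀ {n} a {b} → n < b → suc n < 11 *ℕ a +ℕ 122 *ℕ b
next-grows {n} a {b} n<b = begin-strict
  suc n             ≤⟨ n<b ⟩
  b                 <⟨ ℕ.m<m*n b 122 {{>-nonZero (ℕ.≤-trans (s≤s z≤n) n<b)}} (s≤s (s≤s z≤n)) ⟩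
  b *ℕ 122          ≡⟨ ℕ.*-comm b 122 ⟩
  122 *ℕ b          ≤⟨ ℕ.m≤n+m (122 *ℕ b) (11 *ℕ a) ⟩
  11 *ℕ a +ℕ 122 *ℕ b ∎
  where open ℕ.≤-Reasoning

solutions : ℕ → ℕ × ℕ
solutions zero = 1 , 2
solutions (suc n) = next (solutions n)

solutions-Q : ∀ n → Q⁺ (solutions n) ≡ + 19
solutions-Q zero = refl
solutions-Q (suc n) = trans (Q⁺-next (solutions n)) (solutions-Q n)

solutions-grow : ∀ n → n < proj₂ (solutions n)
solutions-grow zero = s≤s z≤n
solutions-grow (suc n) = next-grows (proj₁ (solutions n)) (solutions-grow n)

lemma6p3 : ((N : ℕ) → ∃₂ λ (a b : ℤ) → Coprimeℤ a b × Q a b ≡ + 19 × N ≤ Data.Nat._+_ ∣ a ∣ ∣ b ∣)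
    × ((a b : ℤ) → Q a b ≡ + 19 → LegendreMinusOne19 (- (+ 5) * (a * a + b * b)))
lemma6p3 = infinitelyMany , λ a b Q≡19 → ¬square⇒LegendreMinusOne19 (solution⇒¬SquareRootMod19 {a} {b} Q≡19)
  where
  infinitelyMany : (N : ℕ) → ∃₂ λ (a b : ℤ) → Coprimeℤ a b × Q a b ≡ + 19 × N ≤ ∣ a ∣ +ℕ ∣ b ∣
  infinitelyMany N =
    let (a , b) = solutions N in
    + a , + b , solution⇒coprime {+ a} {+ b} (solutions-Q N) , solutions-Q N ,
    ℕ.≤-trans (ℕ.<⇒≤ (solutions-grow N)) (ℕ.m≤n+m b a)
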